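{- Let $R$ be a unique factorization domain of prime characteristic $p>0$, let $P,Q\in R$ be non-zero, let $U$ be the Lucas sequence with parameters $P,Q$, assumed regular, and let $\Delta=P^2-4Q$. Let $\mathfrak{p}$ be a prime element of $R$ whose rank of appearance $\rho_U(\mathfrak{p})$ is finite. Then $\mathfrak{p}\mid\Delta$ if and only if $\rho_U(\mathfrak{p})=p$.
   Context: The Lucas sequence with parameters $P,Q$ is defined by $U_0=0$, $U_1=1$, $U_{n+2}=PU_{n+1}-QU_n$ ($n\ge0$). It is non-degenerate if $U_n\ne0$ for all $n\geq1$, and regular if it is non-degenerate and $(P)+(Q)=R$. The rank of appearance $\rho_U(\mathfrak{p})$ is the least $n\ge1$ with $\mathfrak{p}\mid U_n$ ($+\infty$ if none exists). -}

module Defs where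

open import Level using (_⊔_)
open import Algebra.Bundles using (CommutativeRing)
open import Data.Nat as ℕ using (ℕ; zero; suc)
open import Data.List using (List; foldr; length; lookup)
open import Data.List.Relation.Unary.All using (All)
open import Data.Fin using (Fin)
open import Data.Product using (Σ; ∃; _×_)
open import Data.Sum using (_⊎_)
open import Relation.Nullary using (¬_)
open import Function.Bundles using (_↔_; Inverse)

module _ {c ℓ} (R : CommutativeRing c ℓ) where
  open CommutativeRing R

  Divides : Carrier → Carrier → Set (c ⊔ ℓ)
  Divides a b = Σ Carrier λ k → b ≈ k * a

  IsUnit : Carrier → Set (c ⊔ ℓ)
  IsUnit u = Σ Carrier λ v → u * v ≈ 1#

  Associated : Carrier → Carrier → Set (c ⊔ ℓ)
  Associated a b = Σ Carrier λ u → IsUnit u × (b ≈ u * a)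

  IsIntegralDomain : Set (c ⊔ ℓ)
  IsIntegralDomain = (¬ (1# ≈ 0#)) × (∀ a b → a * b ≈ 0# → (a ≈ 0#) ⊎ (b ≈ 0#))

  Irreducible : Carrier → Set (c ⊔ ℓ)
  Irreducible a = (¬ (a ≈ 0#)) × (¬ IsUnit a) × (∀ b d → a ≈ b * d → IsUnit b ⊎ IsUnit d)

  PrimeElement : Carrier → Set (c ⊔ ℓ)
  PrimeElement a = (¬ (a ≈ 0#)) × (¬ IsUnit a) × (∀ b d → Divides a (b * d) → Divides a b ⊎ Divides a d)

  prod : List Carrier → Carrier
  prod = foldr _*_ 1#

  SameUpToAssociates : List Carrier → List Carrier → Set (c ⊔ ℓ)
  SameUpToAssociates xs ys =
    Σ (Fin (length xs) ↔ Fin (length ys)) λ σ →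
      ∀ i → Associated (lookup xs i) (lookup ys (Inverse.to σ i))

  IsUFD : Set (c ⊔ ℓ)
  IsUFD = IsIntegralDomain
        × (∀ a → ¬ (a ≈ 0#) → ¬ IsUnit a → Σ (List Carrier) λ xs → All Irreducible xs × (a ≈ prod xs))
        × (∀ xs ys → All Irreducible xs → All Irreducible ys → prod xs ≈ prod ys → SameUpToAssociates xs ys)

  natCast : ℕ → Carrier
  natCast zero = 0#
  natCast (suc n) = 1# + natCast n

  HasCharacteristic : ℕ → Set ℓ
  HasCharacteristic n = (0 ℕ.< n) × (natCast n ≈ 0#) × (∀ m → 0 ℕ.< m → m ℕ.< n → ¬ (natCast m ≈ 0#))

  lucasU : Carrier → Carrier → ℕ → Carrier
  lucasU P Q zero = 0#
  lucasU P Q (suc zero) = 1#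
  lucasU P Q (suc (suc n)) = P * lucasU P Q (suc n) - Q * lucasU P Q n

  NonDegenerate : Carrier → Carrier → Set ℓ
  NonDegenerate P Q = ∀ n → 1 ℕ.≤ n → ¬ (lucasU P Q n ≈ 0#)

  IsRegular : Carrier → Carrier → Set (c ⊔ ℓ)
  IsRegular P Q = NonDegenerate P Q × (Σ Carrier λ a → Σ Carrier λ b → a * P + b * Q ≈ 1#)

  discriminant : Carrier → Carrier → Carrier
  discriminant P Q = P * P - (Q + Q + Q + Q)

  RankOfAppearanceIs : (ℕ → Carrier) → Carrier → ℕ → Set (c ⊔ ℓ)
  RankOfAppearanceIs U 𝔭 n = (1 ℕ.≤ n) × Divides 𝔭 (U n) × (∀ m → 1 ℕ.≤ m → m ℕ.< n → ¬ Divides 𝔭 (U m))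

  RankOfAppearanceFinite : (ℕ → Carrier) → Carrier → Set (c ⊔ ℓ)
  RankOfAppearanceFinite U 𝔭 = Σ ℕ λ n → (1 ℕ.≤ n) × Divides 𝔭 (U n)

-- Compute in R[√Δ], represented by pairs x + y √Δ. There (P + √Δ)^(n+1) = 2^n (V_(n+1) + U_(n+1) √Δ),
-- while modulo Δ the binomial theorem leaves (P + √Δ)^(n+1) ≡ P^(n+1) + (n+1) P^n √Δ.
-- So if 𝔭 ∣ Δ and 𝔭 ∣ U_m then 𝔭 ∣ m P^(m-1); for 1 < m < p this is impossible, since m is a unit
-- in characteristic p and 𝔭 ∤ P (otherwise 𝔭 ∣ P² - Δ = 4Q, so 𝔭 ∣ Q, contradicting (P) + (Q) = R).
-- In characteristic p the p-th power map is additive, which for odd p gives 2^(p-1) U_p = Δ^((p-1)/2);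
-- hence 𝔭 ∣ U_p iff 𝔭 ∣ Δ. For p = 2 one has U_2 = P and Δ = P².
module Submission where

open import Defs
open import Algebra.Bundles using (CommutativeRing; CommutativeSemiring; RawRing)
open import Algebra.Structures using (IsCommutativeSemiring)
open import Algebra.Structures.Biased using (isCommutativeSemiringˡ)
import Algebra.Solver.Ring.AlmostCommutativeRing as ACR
open import Data.Empty using (⊥-elim)
open import Data.Fin as Fin using (Fin; toℕ; fromℕ; inject₁)
open import Data.Fin.Properties using (toℕ-fromℕ; toℕ-inject₁; toℕ<n)
open import Data.Maybe using (Maybe; just; nothing)
open import Data.Nat as ℕ using (ℕ; zero; suc; _∸_; _<_; _≤_; _!; z≤n; s≤s)
import Data.Nat.Properties as ℕ
open import Data.Nat.Combinatorics using (_C_; nCn≡1; k![n∸k]!∣n!)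
open import Data.Nat.Combinatorics.Specification using (nCk≡n!/k![n-k]!)
open import Data.Nat.Coprimality using (prime⇒coprime; coprime-Bézout)
open import Data.Nat.DivMod using (m/n*n≡m)
open import Data.Nat.GCD using (module Bézout)
open import Data.Nat.Primality using (Prime; euclidsLemma; prime⇒irreducible)
open import Data.Product using (Σ-syntax; ∃-syntax; _×_; _,_; proj₁; proj₂)
open import Data.Product.Properties using (≡-dec)
open import Data.Sum using (_⊎_; inj₁; inj₂; [_,_]′)
open import Data.Vec.Functional using (Vector)
open import Function using (_∘_; id)
open import Function.Bundles using (_⇔_; mk⇔; Equivalence)
open import Relation.Binary.Structures using (IsEquivalence)
open import Relation.Nullary using (¬_; yes; no; contradiction)
import Relation.Binary.PropositionalEquality as ≡
open ≡ using (_≡_)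

module _ where
  open import Data.Nat.Divisibility using (_∣_; divides; ∣⇒≤; m∣m*n)

  prime>1 : ∀ {p} → Prime p → 1 < p
  prime>1 {suc (suc _)} _ = s≤s (s≤s z≤n)

  prime∤! : ∀ {p} → Prime p → ∀ n → n < p → ¬ p ∣ n !
  prime∤! p-prime zero    _   p∣1 = ℕ.<⇒≱ (prime>1 p-prime) (∣⇒≤ p∣1)
  prime∤! p-prime (suc n) n<p p∣n! with euclidsLemma (suc n) (n !) p-prime p∣n!
  ... | inj₁ p∣1+n = ℕ.<⇒≱ n<p (∣⇒≤ p∣1+n)
  ... | inj₂ p∣n!  = prime∤! p-prime n (ℕ.<-trans (ℕ.n<1+n n) n<p) p∣n!

  prime∣pCk : ∀ {p k} → Prime p → 0 < k → k < p → p ∣ p C k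
  prime∣pCk {suc n} {k} p-prime 0<k k<p with euclidsLemma (suc n C k) (k ! ℕ.* (suc n ∸ k) !) p-prime p∣pCk*k![p∸k]!
    where
      pCk*k![p∸k]!≡p! : (suc n C k) ℕ.* (k ! ℕ.* (suc n ∸ k) !) ≡ suc n !
      pCk*k![p∸k]!≡p! = ≡.trans (≡.cong (ℕ._* (k ! ℕ.* (suc n ∸ k) !)) (nCk≡n!/k![n-k]! (ℕ.<⇒≤ k<p)))
                                (m/n*n≡m {{ℕ._!*_!≢0 k (suc n ∸ k)}} (k![n∸k]!∣n! (ℕ.<⇒≤ k<p)))
      p∣pCk*k![p∸k]! : suc n ∣ (suc n C k) ℕ.* (k ! ℕ.* (suc n ∸ k) !)
      p∣pCk*k![p∸k]! = ≡.subst (suc n ∣_) (≡.sym pCk*k![p∸k]!≡p!) (m∣m*n (n !))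
  ... | inj₁ p∣pCk        = p∣pCk
  ... | inj₂ p∣k![p∸k]! with euclidsLemma (k !) ((suc n ∸ k) !) p-prime p∣k![p∸k]!
  ...   | inj₁ p∣k!     = contradiction p∣k! (prime∤! p-prime k k<p)
  ...   | inj₂ p∣[p∸k]! = contradiction p∣[p∸k]! (prime∤! p-prime (suc n ∸ k) (ℕ.∸-monoʳ-< 0<k (ℕ.<⇒≤ k<p)))

  even⊎odd : ∀ n → ∃[ m ] (n ≡ m ℕ.+ m ⊎ n ≡ suc (m ℕ.+ m))
  even⊎odd zero = 0 , inj₁ ≡.refl
  even⊎odd (suc n) with even⊎odd n
  ... | m , inj₁ n≡m+m   = m , inj₂ (≡.cong suc n≡m+m)
  ... | m , inj₂ n≡1+m+m = suc m , inj₁ (≡.cong suc (≡.trans n≡1+m+m (≡.sym (ℕ.+-suc m m))))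

  prime≡2⊎odd : ∀ {p} → Prime p → p ≡ 2 ⊎ ∃[ m ] p ≡ suc (suc m ℕ.+ suc m)
  prime≡2⊎odd {p} p-prime with even⊎odd p
  ... | m , inj₁ p≡m+m with prime⇒irreducible p-prime (divides m (≡.trans p≡m+m m+m≡m*2))
    where
      m+m≡m*2 : m ℕ.+ m ≡ m ℕ.* 2
      m+m≡m*2 = ≡.sym (≡.trans (ℕ.*-comm m 2) (≡.cong (m ℕ.+_) (ℕ.+-identityʳ m)))
  ...   | inj₁ ()
  ...   | inj₂ 2≡p = inj₁ (≡.sym 2≡p)
  prime≡2⊎odd p-prime | zero  , inj₂ ≡.refl = contradiction (prime>1 p-prime) λ { (s≤s ()) }
  prime≡2⊎odd p-prime | suc m , inj₂ p≡2m+3 = inj₂ (m , p≡2m+3)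

module _ {a ℓ} (S : CommutativeSemiring a ℓ) where
  open CommutativeSemiring S
  open import Data.Nat.Divisibility using (divides)
  open import Algebra.Properties.Semiring.Mult semiring using (×-congʳ; ×-assocˡ; ×-assoc-*) renaming (_×_ to _·_)
  open import Algebra.Properties.Semiring.Exp semiring using (_^_)
  open import Algebra.Properties.Monoid.Sum +-monoid using (sum)
  import Algebra.Properties.CommutativeSemiring.Binomial S as Binomial
  open import Relation.Binary.Reasoning.Setoid setoid

  sum≈last : ∀ {n} (t : Vector Carrier (suc n)) → (∀ i → t (inject₁ i) ≈ 0#) → sum t ≈ t (fromℕ n)
  sum≈last {zero}  t _      = +-identityʳ (t Fin.zero)
  sum≈last {suc n} t t[i]≈0 = begin
    t Fin.zero + sum (t ∘ Fin.suc) ≈⟨ +-cong (t[i]≈0 Fin.zero) (sum≈last (t ∘ Fin.suc) (t[i]≈0 ∘ Fin.suc)) ⟩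
    0# + t (fromℕ (suc n))         ≈⟨ +-identityˡ _ ⟩
    t (fromℕ (suc n))              ∎

  char-annihilates : ∀ {p} → p · 1# ≈ 0# → ∀ x → p · x ≈ 0#
  char-annihilates {p} p≈0 x = begin
    p · x         ≈⟨ ×-congʳ p (*-identityˡ x) ⟨
    p · (1# * x)  ≈⟨ ×-assoc-* p 1# x ⟨
    (p · 1#) * x  ≈⟨ *-congʳ p≈0 ⟩
    0# * x        ≈⟨ zeroˡ x ⟩
    0#            ∎

  freshman's-dream : ∀ {p} → Prime p → p · 1# ≈ 0# → ∀ x y → (x + y) ^ p ≈ x ^ p + y ^ p
  freshman's-dream {suc n} p-prime p≈0 x y = begin
    (x + y) ^ suc n                       ≈⟨ Binomial.theorem (suc n) x y ⟩
    term Fin.zero + sum (term ∘ Fin.suc)  ≈⟨ +-cong first (sum≈last (term ∘ Fin.suc) interior) ⟩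
    y ^ suc n + term (fromℕ (suc n))      ≈⟨ +-congˡ (last (fromℕ (suc n)) (toℕ-fromℕ (suc n))) ⟩
    y ^ suc n + x ^ suc n                 ≈⟨ +-comm _ _ ⟩
    x ^ suc n + y ^ suc n                 ∎
    where
      term : Fin (suc (suc n)) → Carrier
      term = Binomial.binomialTerm x y (suc n)

      first : term Fin.zero ≈ y ^ suc n
      first = trans (+-identityʳ _) (*-identityˡ _)

      interior : ∀ (i : Fin n) → term (Fin.suc (inject₁ i)) ≈ 0#
      interior i with prime∣pCk p-prime (s≤s z≤n) (s≤s (ℕ.≤-trans (ℕ.≤-reflexive (≡.cong suc (toℕ-inject₁ i))) (toℕ<n i)))
      ... | divides q pCk≡q*p = begin
        (suc n C toℕ k) · b  ≡⟨ ≡.cong (_· b) (≡.trans pCk≡q*p (ℕ.*-comm q (suc n))) ⟩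
        (suc n ℕ.* q) · b    ≈⟨ ×-assocˡ b (suc n) q ⟨
        suc n · (q · b)      ≈⟨ char-annihilates {suc n} p≈0 (q · b) ⟩
        0#                   ∎
        where
          k = Fin.suc (inject₁ i)
          b = Binomial.binomial x y (suc n) k

      last : ∀ k → toℕ k ≡ suc n → term k ≈ x ^ suc n
      last k k≡p rewrite k≡p | nCn≡1 (suc n) | ℕ.n∸n≡0 (suc n) = trans (+-identityʳ _) (*-identityʳ _)

module IntegerCoefficients {c ℓ} (R : CommutativeRing c ℓ) where
  open CommutativeRing R
  open import Algebra.Properties.Ring ring using (x[y-z]≈xy-xz; [y-z]x≈yx-zx)
  open import Algebra.Properties.AbelianGroup +-abelianGroup using (⁻¹-∙-comm; ⁻¹-anti-homo‿-; ε⁻¹≈ε)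
  open import Algebra.Properties.CommutativeSemigroup +-commutativeSemigroup using (interchange)
  open import Algebra.Properties.Semiring.Mult.TCOptimised semiring
    using (×-homo-+; ×1-homo-*) renaming (_×_ to _·_)
  open import Relation.Binary.Reasoning.Setoid setoid

  module Coefficients where
    -‿+-split : ∀ x y z w → (x + y) - (z + w) ≈ (x - z) + (y - w)
    -‿+-split x y z w = trans (+-congˡ (sym (⁻¹-∙-comm z w))) (interchange x y (- z) (- w))

    -‿-‿regroup : ∀ x y z w → (x - y) - (z - w) ≈ (x + w) - (y + z)
    -‿-‿regroup x y z w = begin
      (x - y) - (z - w)    ≈⟨ +-congˡ (⁻¹-anti-homo‿- z w) ⟩
      (x - y) + (w - z)    ≈⟨ interchange x (- y) w (- z) ⟩
      (x + w) + (- y - z)  ≈⟨ +-congˡ (⁻¹-∙-comm y z) ⟩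
      (x + w) - (y + z)    ∎

    -- The pair (a , b) stands for a − b. The ring operations return the normal form with a = 0
    -- or b = 0, so that equal integers are syntactically equal, as the solver's final `refl`
    -- requires; and ⟦_⟧ sends 0 and 1 to 0# and 1# on the nose.
    ℤ₋ : Set
    ℤ₋ = ℕ × ℕ

    normalise : ℕ → ℕ → ℤ₋
    normalise a b = (a ∸ b , b ∸ a)

    _⊝_ : ℕ → ℕ → Carrier
    a ⊝ b = a · 1# - b · 1#

    ⟦_⟧ : ℤ₋ → Carrier
    ⟦ a , zero  ⟧ = a · 1#
    ⟦ a , suc b ⟧ = a ⊝ suc b

    ⟦⟧≈⊝ : ∀ a b → ⟦ a , b ⟧ ≈ a ⊝ b
    ⟦⟧≈⊝ a zero    = sym (trans (+-congˡ ε⁻¹≈ε) (+-identityʳ _))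
    ⟦⟧≈⊝ a (suc b) = refl

    ⊝-cancelʳ : ∀ a b k → (a ℕ.+ k) ⊝ (b ℕ.+ k) ≈ a ⊝ b
    ⊝-cancelʳ a b k = begin
      (a ℕ.+ k) ⊝ (b ℕ.+ k)                 ≈⟨ +-cong (×-homo-+ 1# a k) (-‿cong (×-homo-+ 1# b k)) ⟩
      (a · 1# + k · 1#) - (b · 1# + k · 1#) ≈⟨ -‿+-split _ _ _ _ ⟩
      a ⊝ b + (k · 1# - k · 1#)             ≈⟨ +-congˡ (-‿inverseʳ _) ⟩
      a ⊝ b + 0#                            ≈⟨ +-identityʳ _ ⟩
      a ⊝ b                                 ∎

    ⊝-normalise : ∀ a b → (a ∸ b) ⊝ (b ∸ a) ≈ a ⊝ b
    ⊝-normalise a b with ℕ.≤-total a b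
    ... | inj₁ a≤b = sym (begin
      a ⊝ b                              ≡⟨ ≡.cong₂ _⊝_ (≡.cong (ℕ._+ a) (ℕ.m≤n⇒m∸n≡0 a≤b)) (ℕ.m∸n+n≡m a≤b) ⟨
      ((a ∸ b) ℕ.+ a) ⊝ ((b ∸ a) ℕ.+ a)  ≈⟨ ⊝-cancelʳ (a ∸ b) (b ∸ a) a ⟩
      (a ∸ b) ⊝ (b ∸ a)                  ∎)
    ... | inj₂ b≤a = sym (begin
      a ⊝ b                              ≡⟨ ≡.cong₂ _⊝_ (ℕ.m∸n+n≡m b≤a) (≡.cong (ℕ._+ b) (ℕ.m≤n⇒m∸n≡0 b≤a)) ⟨
      ((a ∸ b) ℕ.+ b) ⊝ ((b ∸ a) ℕ.+ b)  ≈⟨ ⊝-cancelʳ (a ∸ b) (b ∸ a) b ⟩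
      (a ∸ b) ⊝ (b ∸ a)                  ∎)

    ⟦normalise⟧ : ∀ a b → ⟦ normalise a b ⟧ ≈ a ⊝ b
    ⟦normalise⟧ a b = trans (⟦⟧≈⊝ (a ∸ b) (b ∸ a)) (⊝-normalise a b)

    _⊕_ _⊗_ : ℤ₋ → ℤ₋ → ℤ₋
    (a , b) ⊕ (c , d) = normalise (a ℕ.+ c) (b ℕ.+ d)
    (a , b) ⊗ (c , d) = normalise (a ℕ.* c ℕ.+ b ℕ.* d) (a ℕ.* d ℕ.+ b ℕ.* c)

    ⊕-homo : ∀ x y → ⟦ x ⊕ y ⟧ ≈ ⟦ x ⟧ + ⟦ y ⟧
    ⊕-homo (a , b) (c , d) = begin
      ⟦ normalise (a ℕ.+ c) (b ℕ.+ d) ⟧      ≈⟨ ⟦normalise⟧ (a ℕ.+ c) (b ℕ.+ d) ⟩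
      (a ℕ.+ c) ⊝ (b ℕ.+ d)                  ≈⟨ +-cong (×-homo-+ 1# a c) (-‿cong (×-homo-+ 1# b d)) ⟩
      (a · 1# + c · 1#) - (b · 1# + d · 1#)  ≈⟨ -‿+-split _ _ _ _ ⟩
      a ⊝ b + c ⊝ d                          ≈⟨ +-cong (⟦⟧≈⊝ a b) (⟦⟧≈⊝ c d) ⟨
      ⟦ a , b ⟧ + ⟦ c , d ⟧                  ∎

    ⊗-homo : ∀ x y → ⟦ x ⊗ y ⟧ ≈ ⟦ x ⟧ * ⟦ y ⟧
    ⊗-homo (a , b) (c , d) = begin
      ⟦ normalise (a ℕ.* c ℕ.+ b ℕ.* d) (a ℕ.* d ℕ.+ b ℕ.* c) ⟧
        ≈⟨ ⟦normalise⟧ (a ℕ.* c ℕ.+ b ℕ.* d) (a ℕ.* d ℕ.+ b ℕ.* c) ⟩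
      (a ℕ.* c ℕ.+ b ℕ.* d) ⊝ (a ℕ.* d ℕ.+ b ℕ.* c)
        ≈⟨ +-cong (·1-homo-+* a c b d) (-‿cong (·1-homo-+* a d b c)) ⟩
      ([a] * [c] + [b] * [d]) - ([a] * [d] + [b] * [c])
        ≈⟨ -‿-‿regroup ([a] * [c]) ([a] * [d]) ([b] * [c]) ([b] * [d]) ⟨
      ([a] * [c] - [a] * [d]) - ([b] * [c] - [b] * [d])
        ≈⟨ +-cong (x[y-z]≈xy-xz [a] [c] [d]) (-‿cong (x[y-z]≈xy-xz [b] [c] [d])) ⟨
      [a] * ([c] - [d]) - [b] * ([c] - [d])
        ≈⟨ [y-z]x≈yx-zx ([c] - [d]) [a] [b] ⟨
      ([a] - [b]) * ([c] - [d])
        ≈⟨ *-cong (⟦⟧≈⊝ a b) (⟦⟧≈⊝ c d) ⟨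
      ⟦ a , b ⟧ * ⟦ c , d ⟧
        ∎
      where
        [a] = a · 1#; [b] = b · 1#; [c] = c · 1#; [d] = d · 1#
        ·1-homo-+* : ∀ m n k l → (m ℕ.* n ℕ.+ k ℕ.* l) · 1# ≈ (m · 1#) * (n · 1#) + (k · 1#) * (l · 1#)
        ·1-homo-+* m n k l = trans (×-homo-+ 1# (m ℕ.* n) (k ℕ.* l)) (+-cong (×1-homo-* m n) (×1-homo-* k l))

    ℤ₋-rawRing : RawRing _ _
    ℤ₋-rawRing = record
      { Carrier = ℤ₋ ; _≈_ = _≡_ ; _+_ = _⊕_ ; _*_ = _⊗_
      ; -_ = λ (a , b) → (b , a) ; 0# = (0 , 0) ; 1# = (1 , 0)
      }

    homomorphism : ℤ₋-rawRing ACR.-Raw-AlmostCommutative⟶ ACR.fromCommutativeRing R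
    homomorphism = record
      { ⟦_⟧    = ⟦_⟧
      ; +-homo = ⊕-homo
      ; *-homo = ⊗-homo
      ; -‿homo = λ (a , b) → trans (⟦⟧≈⊝ b a)
                               (trans (sym (⁻¹-anti-homo‿- (a · 1#) (b · 1#))) (-‿cong (sym (⟦⟧≈⊝ a b))))
      ; 0-homo = refl
      ; 1-homo = refl
      }

    ≟-weak : ∀ x y → Maybe (⟦ x ⟧ ≈ ⟦ y ⟧)
    ≟-weak x y with ≡-dec ℕ._≟_ ℕ._≟_ x y
    ... | yes ≡.refl = just refl
    ... | no _       = nothing

  open Coefficients using (ℤ₋-rawRing; homomorphism; ≟-weak)
  open import Algebra.Solver.Ring ℤ₋-rawRing (ACR.fromCommutativeRing R) homomorphism ≟-weak public

module _ {c ℓ} (R : CommutativeRing c ℓ) where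
  open CommutativeRing R
  open IntegerCoefficients R using (solve; Polynomial; con; _:+_; _:*_; _:-_; :-_; _:=_)
  open import Algebra.Properties.Ring ring using (-‿distribˡ-*)
  open import Algebra.Properties.Semiring.Mult semiring using (×1-homo-*) renaming (_×_ to _·_)
  open import Algebra.Properties.Semiring.Exp semiring using (_^_)
  open import Relation.Binary.Reasoning.Setoid setoid

  private
    infix 4 _∣_
    _∣_ : Carrier → Carrier → Set _
    _∣_ = Divides R

    𝟎 𝟏 𝟐 : ∀ {n} → Polynomial n
    𝟎 = con (0 , 0)
    𝟏 = con (1 , 0)
    𝟐 = con (2 , 0)

  2# : Carrier
  2# = 1# + 1#

  natCast≈·1 : ∀ n → natCast R n ≈ n · 1#
  natCast≈·1 zero    = refl
  natCast≈·1 (suc n) = +-congˡ (natCast≈·1 n)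

  ∣-respʳ : ∀ {d x y} → x ≈ y → d ∣ x → d ∣ y
  ∣-respʳ x≈y (k , x≈kd) = k , trans (sym x≈y) x≈kd

  ∣n⇒∣m*n : ∀ {d n} m → d ∣ n → d ∣ m * n
  ∣n⇒∣m*n {d} m (k , n≈kd) = m * k , trans (*-congˡ n≈kd) (sym (*-assoc m k d))

  ∣m⇒∣m*n : ∀ {d m} n → d ∣ m → d ∣ m * n
  ∣m⇒∣m*n n d∣m = ∣-respʳ (*-comm n _) (∣n⇒∣m*n n d∣m)

  ∣m∣n⇒∣m+n : ∀ {d m n} → d ∣ m → d ∣ n → d ∣ m + n
  ∣m∣n⇒∣m+n {d} (k , m≈kd) (l , n≈ld) = k + l , trans (+-cong m≈kd n≈ld) (sym (distribʳ d k l))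

  ∣m∣n⇒∣m-n : ∀ {d m n} → d ∣ m → d ∣ n → d ∣ m - n
  ∣m∣n⇒∣m-n {d} d∣m (l , n≈ld) = ∣m∣n⇒∣m+n d∣m (- l , trans (-‿cong n≈ld) (-‿distribˡ-* l d))

  ∣m+n∣n⇒∣m : ∀ {d m n} → d ∣ m + n → d ∣ n → d ∣ m
  ∣m+n∣n⇒∣m {d} {m} {n} d∣m+n d∣n = ∣-respʳ m+n-n≈m (∣m∣n⇒∣m-n d∣m+n d∣n)
    where
      m+n-n≈m : m + n - n ≈ m
      m+n-n≈m = trans (+-assoc m n (- n)) (trans (+-congˡ (-‿inverseʳ n)) (+-identityʳ m))

  module _ {𝔭} (𝔭-prime : PrimeElement R 𝔭) where

    prime∣*⇒∣⊎∣ : ∀ x y → 𝔭 ∣ x * y → 𝔭 ∣ x ⊎ 𝔭 ∣ y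
    prime∣*⇒∣⊎∣ = proj₂ (proj₂ 𝔭-prime)

    prime∤unit : ∀ {u} → IsUnit R u → ¬ 𝔭 ∣ u
    prime∤unit {u} (v , uv≈1) (k , u≈k𝔭) = proj₁ (proj₂ 𝔭-prime) (k * v , (begin
      𝔭 * (k * v)  ≈⟨ solve 3 (λ p k v → p :* (k :* v) := (k :* p) :* v) refl 𝔭 k v ⟩
      (k * 𝔭) * v  ≈⟨ *-congʳ u≈k𝔭 ⟨
      u * v        ≈⟨ uv≈1 ⟩
      1#           ∎))

    prime∣^⇒∣ : ∀ x n → 𝔭 ∣ x ^ n → 𝔭 ∣ x
    prime∣^⇒∣ x zero    𝔭∣1 = contradiction 𝔭∣1 (prime∤unit (1# , *-identityʳ 1#))
    prime∣^⇒∣ x (suc n) 𝔭∣x^[1+n] with prime∣*⇒∣⊎∣ x (x ^ n) 𝔭∣x^[1+n]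
    ... | inj₁ 𝔭∣x   = 𝔭∣x
    ... | inj₂ 𝔭∣x^n = prime∣^⇒∣ x n 𝔭∣x^n

  ·1-cong : ∀ {m n} → m ≡ n → m · 1# ≈ n · 1#
  ·1-cong m≡n = reflexive (≡.cong (_· 1#) m≡n)

  multiple-of-char·1≈0 : ∀ {p} → p · 1# ≈ 0# → ∀ x → (x ℕ.* p) · 1# ≈ 0#
  multiple-of-char·1≈0 {p} p≈0 x = trans (×1-homo-* x p) (trans (*-congˡ p≈0) (zeroʳ _))

  -- A Bézout relation 1 + y n = x p (or 1 + x p = y n) becomes an inverse of n once p vanishes.
  ·1-isUnit : ∀ {p n} → Prime p → p · 1# ≈ 0# → 0 < n → n < p → IsUnit R (n · 1#)
  ·1-isUnit {p} {suc n} p-prime p≈0 _ n<p with coprime-Bézout (prime⇒coprime p-prime n<p)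
  ... | Bézout.+- x y 1+yn≡xp = - (y · 1#) , (begin
    N * - (y · 1#)          ≈⟨ solve 2 (λ N Y → N :* (:- Y) := 𝟏 :- (𝟏 :+ Y :* N)) refl N (y · 1#) ⟩
    1# - (1# + y · 1# * N)  ≈⟨ +-congˡ (-‿cong (trans (+-congˡ (sym (×1-homo-* y (suc n)))) (·1-cong 1+yn≡xp))) ⟩
    1# - (x ℕ.* p) · 1#     ≈⟨ +-congˡ (-‿cong (multiple-of-char·1≈0 p≈0 x)) ⟩
    1# - 0#                 ≈⟨ solve 0 (𝟏 :- 𝟎 := 𝟏) refl ⟩
    1#                      ∎)
    where
      N = suc n · 1#
  ... | Bézout.-+ x y 1+xp≡yn = y · 1# , (begin
    N * y · 1#              ≈⟨ *-comm N _ ⟩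
    y · 1# * N              ≈⟨ ×1-homo-* y (suc n) ⟨
    (y ℕ.* suc n) · 1#      ≈⟨ ·1-cong 1+xp≡yn ⟨
    1# + (x ℕ.* p) · 1#     ≈⟨ +-congˡ (multiple-of-char·1≈0 p≈0 x) ⟩
    1# + 0#                 ≈⟨ +-identityʳ 1# ⟩
    1#                      ∎)
    where
      N = suc n · 1#

  -- x + y √D is the pair (x , y); D need not be a square in R.
  module Adjoin√ (D : Carrier) where

    infix  4 _≋_
    infixl 6 _⊕_
    infixl 7 _⊛_

    _≋_ : Carrier × Carrier → Carrier × Carrier → Set ℓ
    (a , b) ≋ (c , d) = (a ≈ c) × (b ≈ d)

    _⊕_ _⊛_ : Carrier × Carrier → Carrier × Carrier → Carrier × Carrier
    (a , b) ⊕ (c , d) = (a + c , b + d)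
    (a , b) ⊛ (c , d) = (a * c + D * (b * d) , a * d + b * c)

    ι : Carrier → Carrier × Carrier
    ι x = (x , 0#)

    √D : Carrier × Carrier
    √D = (0# , 1#)

    ≋-trans : ∀ {x y z} → x ≋ y → y ≋ z → x ≋ z
    ≋-trans (a , b) (c , d) = trans a c , trans b d

    ≋-isEquivalence : IsEquivalence _≋_
    ≋-isEquivalence = record { refl = refl , refl ; sym = λ (a , b) → sym a , sym b ; trans = ≋-trans }

    ⊕-cong : ∀ {x y u v} → x ≋ y → u ≋ v → x ⊕ u ≋ y ⊕ v
    ⊕-cong (a , b) (c , d) = +-cong a c , +-cong b d

    ⊛-cong : ∀ {x y u v} → x ≋ y → u ≋ v → x ⊛ u ≋ y ⊛ v
    ⊛-cong (a , b) (c , d) = +-cong (*-cong a c) (*-congˡ (*-cong b d)) , +-cong (*-cong a d) (*-cong b c)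

    ⊛-congˡ : ∀ x {u v} → u ≋ v → x ⊛ u ≋ x ⊛ v
    ⊛-congˡ x = ⊛-cong {x = x} (refl , refl)

    ⊛-assoc : ∀ x y z → (x ⊛ y) ⊛ z ≋ x ⊛ (y ⊛ z)
    ⊛-assoc (a , b) (c , d) (e , f) =
        solve 7 (λ D a b c d e f → (a :* c :+ D :* (b :* d)) :* e :+ D :* ((a :* d :+ b :* c) :* f)
                                  := a :* (c :* e :+ D :* (d :* f)) :+ D :* (b :* (c :* f :+ d :* e))) refl D a b c d e f
      , solve 7 (λ D a b c d e f → (a :* c :+ D :* (b :* d)) :* f :+ (a :* d :+ b :* c) :* e
                                  := a :* (c :* f :+ d :* e) :+ b :* (c :* e :+ D :* (d :* f))) refl D a b c d e f

    ⊛-comm : ∀ x y → x ⊛ y ≋ y ⊛ x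
    ⊛-comm (a , b) (c , d) =
        solve 5 (λ D a b c d → a :* c :+ D :* (b :* d) := c :* a :+ D :* (d :* b)) refl D a b c d
      , solve 4 (λ a b c d → a :* d :+ b :* c := c :* b :+ d :* a) refl a b c d

    ⊛-identityˡ : ∀ x → ι 1# ⊛ x ≋ x
    ⊛-identityˡ (a , b) =
        solve 3 (λ D a b → 𝟏 :* a :+ D :* (𝟎 :* b) := a) refl D a b
      , solve 2 (λ a b → 𝟏 :* b :+ 𝟎 :* a := b) refl a b

    ⊛-distribʳ : ∀ x y z → (y ⊕ z) ⊛ x ≋ y ⊛ x ⊕ z ⊛ x
    ⊛-distribʳ (a , b) (c , d) (e , f) =
        solve 7 (λ D a b c d e f → (c :+ e) :* a :+ D :* ((d :+ f) :* b)
                                  := (c :* a :+ D :* (d :* b)) :+ (e :* a :+ D :* (f :* b))) refl D a b c d e f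
      , solve 6 (λ a b c d e f → (c :+ e) :* b :+ (d :+ f) :* a := (c :* b :+ d :* a) :+ (e :* b :+ f :* a)) refl a b c d e f

    ⊛-zeroˡ : ∀ x → ι 0# ⊛ x ≋ ι 0#
    ⊛-zeroˡ (a , b) =
        solve 3 (λ D a b → 𝟎 :* a :+ D :* (𝟎 :* b) := 𝟎) refl D a b
      , solve 2 (λ a b → 𝟎 :* b :+ 𝟎 :* a := 𝟎) refl a b

    ⊕-⊛-isCommutativeSemiring : IsCommutativeSemiring _≋_ _⊕_ _⊛_ (ι 0#) (ι 1#)
    ⊕-⊛-isCommutativeSemiring = isCommutativeSemiringˡ record
      { +-isCommutativeMonoid = record
        { isMonoid = record
          { isSemigroup = record
            { isMagma = record { isEquivalence = ≋-isEquivalence ; ∙-cong = ⊕-cong }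
            ; assoc   = λ _ _ _ → +-assoc _ _ _ , +-assoc _ _ _ }
          ; identity = (λ _ → +-identityˡ _ , +-identityˡ _) , (λ _ → +-identityʳ _ , +-identityʳ _) }
        ; comm = λ _ _ → +-comm _ _ , +-comm _ _ }
      ; *-isCommutativeMonoid = record
        { isMonoid = record
          { isSemigroup = record
            { isMagma = record { isEquivalence = ≋-isEquivalence ; ∙-cong = ⊛-cong }
            ; assoc   = ⊛-assoc }
          ; identity = ⊛-identityˡ , λ x → ≋-trans (⊛-comm x (ι 1#)) (⊛-identityˡ x) }
        ; comm = ⊛-comm }
      ; distribʳ = ⊛-distribʳ
      ; zeroˡ    = ⊛-zeroˡ
      }

    R[√D] : CommutativeSemiring c ℓ
    R[√D] = record { isCommutativeSemiring = ⊕-⊛-isCommutativeSemiring }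

    open import Algebra.Properties.Semiring.Exp (CommutativeSemiring.semiring R[√D])
      using () renaming (_^_ to _^′_) public
    open import Algebra.Properties.Semiring.Mult (CommutativeSemiring.semiring R[√D])
      using () renaming (_×_ to _·′_) public

    ·′-componentwise : ∀ n a b → n ·′ (a , b) ≋ (n · a , n · b)
    ·′-componentwise zero    a b = refl , refl
    ·′-componentwise (suc n) a b = ⊕-cong {x = (a , b)} (refl , refl) (·′-componentwise n a b)

    ι-^′ : ∀ x n → ι x ^′ n ≋ ι (x ^ n)
    ι-^′ x zero    = refl , refl
    ι-^′ x (suc n) = ≋-trans (⊛-congˡ (ι x) (ι-^′ x n))
      ( solve 3 (λ D x y → x :* y :+ D :* (𝟎 :* 𝟎) := x :* y) refl D x (x ^ n)
      , solve 2 (λ x y → x :* 𝟎 :+ 𝟎 :* y := 𝟎) refl x (x ^ n) )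

    √D^[m+m] : ∀ m → √D ^′ (m ℕ.+ m) ≋ ι (D ^ m)
    √D^[m+m] zero = refl , refl
    √D^[m+m] (suc m) rewrite ℕ.+-suc m m = ≋-trans (⊛-congˡ √D (⊛-congˡ √D (√D^[m+m] m)))
      ( solve 2 (λ D y → 𝟎 :* (𝟎 :* y :+ D :* (𝟏 :* 𝟎)) :+ D :* (𝟏 :* (𝟎 :* 𝟎 :+ 𝟏 :* y)) := D :* y) refl D (D ^ m)
      , solve 2 (λ D y → 𝟎 :* (𝟎 :* 𝟎 :+ 𝟏 :* y) :+ 𝟏 :* (𝟎 :* y :+ D :* (𝟏 :* 𝟎)) := 𝟎) refl D (D ^ m) )

    [√D+ιx]^[n+1]≋mod-D : ∀ x n → Σ[ a ∈ Carrier ] Σ[ b ∈ Carrier ]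
                             (√D ⊕ ι x) ^′ suc n ≋ (x ^ suc n + D * a , suc n · 1# * x ^ n + D * b)
    [√D+ιx]^[n+1]≋mod-D x zero = 0# , 0# ,
        solve 2 (λ D x → (𝟎 :+ x) :* 𝟏 :+ D :* ((𝟏 :+ 𝟎) :* 𝟎) := x :* 𝟏 :+ D :* 𝟎) refl D x
      , solve 2 (λ D x → (𝟎 :+ x) :* 𝟎 :+ (𝟏 :+ 𝟎) :* 𝟏 := (𝟏 :+ 𝟎) :* 𝟏 :+ D :* 𝟎) refl D x
    [√D+ιx]^[n+1]≋mod-D x (suc n) with [√D+ιx]^[n+1]≋mod-D x n
    ... | a , b , ω^[n+1]≋ = x * a + (k * x ^ n + D * b) , a + x * b , ≋-trans (⊛-congˡ (√D ⊕ ι x) ω^[n+1]≋)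
        ( solve 6 (λ D x a b k y → (𝟎 :+ x) :* (x :* y :+ D :* a) :+ D :* ((𝟏 :+ 𝟎) :* (k :* y :+ D :* b))
                                    := x :* (x :* y) :+ D :* (x :* a :+ (k :* y :+ D :* b))) refl D x a b k (x ^ n)
        , solve 6 (λ D x a b k y → (𝟎 :+ x) :* (k :* y :+ D :* b) :+ (𝟏 :+ 𝟎) :* (x :* y :+ D :* a)
                                    := (𝟏 :+ k) :* (x :* y) :+ D :* (a :+ x :* b)) refl D x a b k (x ^ n) )
      where
        k = suc n · 1#

    proj₂[√D+ιx]^p≈D^m : ∀ {p m} x → Prime p → p · 1# ≈ 0# → p ≡ suc (m ℕ.+ m) → proj₂ ((√D ⊕ ι x) ^′ p) ≈ D ^ m
    proj₂[√D+ιx]^p≈D^m {p} {m} x p-prime p≈0 ≡.refl = begin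
      proj₂ ((√D ⊕ ι x) ^′ p)                          ≈⟨ proj₂ (freshman's-dream R[√D] p-prime p≈0′ √D (ι x)) ⟩
      proj₂ (√D ⊛ √D ^′ (m ℕ.+ m)) + proj₂ (ι x ^′ p)  ≈⟨ +-cong (proj₂ (⊛-congˡ √D (√D^[m+m] m))) (proj₂ (ι-^′ x p)) ⟩
      (0# * 0# + 1# * D ^ m) + 0#                      ≈⟨ solve 1 (λ y → (𝟎 :* 𝟎 :+ 𝟏 :* y) :+ 𝟎 := y) refl (D ^ m) ⟩
      D ^ m                                            ∎
      where
        p≈0′ : p ·′ ι 1# ≋ ι 0#
        p≈0′ = ≋-trans (·′-componentwise p 1# 0#) (p≈0 , char-annihilates commutativeSemiring {p} p≈0 0#)

  module Lucas (P Q : Carrier) where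
    U : ℕ → Carrier
    U = lucasU R P Q

    Δ : Carrier
    Δ = discriminant R P Q

    open Adjoin√ Δ

    -- With α, β = (P ± √Δ)/2 this is (2α)^(n+1) = 2^n (V_(n+1) + U_(n+1) √Δ), where V_n = 2 U_(n+1) - P U_n.
    [P+√Δ]^[n+1] : ∀ n → (√D ⊕ ι P) ^′ suc n ≋ (2# ^ n * (2# * U (suc (suc n)) - P * U (suc n)) , 2# ^ n * U (suc n))
    [P+√Δ]^[n+1] zero =
        solve 2 (λ P Q → (𝟎 :+ P) :* 𝟏 :+ (P :* P :- (Q :+ Q :+ Q :+ Q)) :* ((𝟏 :+ 𝟎) :* 𝟎)
                        := 𝟏 :* (𝟐 :* (P :* 𝟏 :- Q :* 𝟎) :- P :* 𝟏)) refl P Q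
      , solve 1 (λ P → (𝟎 :+ P) :* 𝟎 :+ (𝟏 :+ 𝟎) :* 𝟏 := 𝟏 :* 𝟏) refl P
    [P+√Δ]^[n+1] (suc n) = ≋-trans (⊛-congˡ (√D ⊕ ι P) ([P+√Δ]^[n+1] n))
        ( solve 5 (λ P Q t u v → (𝟎 :+ P) :* (t :* (𝟐 :* v :- P :* u)) :+ (P :* P :- (Q :+ Q :+ Q :+ Q)) :* ((𝟏 :+ 𝟎) :* (t :* u))
                                  := (𝟐 :* t) :* (𝟐 :* (P :* v :- Q :* u) :- P :* v)) refl P Q t u v
        , solve 5 (λ P Q t u v → (𝟎 :+ P) :* (t :* u) :+ (𝟏 :+ 𝟎) :* (t :* (𝟐 :* v :- P :* u))
                                  := (𝟐 :* t) :* v) refl P Q t u v )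
      where
        t = 2# ^ n
        u = U (suc n)
        v = U (suc (suc n))

    2^n*U[n+1]≡[n+1]P^n[mod-Δ] : ∀ n → Σ[ b ∈ Carrier ] 2# ^ n * U (suc n) ≈ suc n · 1# * P ^ n + Δ * b
    2^n*U[n+1]≡[n+1]P^n[mod-Δ] n with [√D+ιx]^[n+1]≋mod-D P n
    ... | _ , b , ω^[n+1]≋ = b , trans (sym (proj₂ ([P+√Δ]^[n+1] n))) (proj₂ ω^[n+1]≋)

    2^[p-1]*U[p]≈Δ^[[p-1]/2] : ∀ {p m} → Prime p → p · 1# ≈ 0# → p ≡ suc (m ℕ.+ m) → 2# ^ (m ℕ.+ m) * U p ≈ Δ ^ m
    2^[p-1]*U[p]≈Δ^[[p-1]/2] {m = m} p-prime p≈0 ≡.refl =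
      trans (sym (proj₂ ([P+√Δ]^[n+1] (m ℕ.+ m)))) (proj₂[√D+ιx]^p≈D^m {m = m} P p-prime p≈0 ≡.refl)

  module _ {p} (p-prime : Prime p) (p≈0 : p · 1# ≈ 0#)
           {P Q} (P,Q-comaximal : Σ[ a ∈ Carrier ] Σ[ b ∈ Carrier ] a * P + b * Q ≈ 1#)
           {𝔭} (𝔭-prime : PrimeElement R 𝔭) where
    open Lucas P Q

    prime∤2 : 2 < p → ¬ 𝔭 ∣ 2#
    prime∤2 2<p 𝔭∣2 = prime∤unit 𝔭-prime (·1-isUnit p-prime p≈0 (s≤s z≤n) 2<p)
                                         (∣-respʳ (+-congˡ (sym (+-identityʳ 1#))) 𝔭∣2)

    prime∣P⇒∤Q : 𝔭 ∣ P → ¬ 𝔭 ∣ Q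
    prime∣P⇒∤Q 𝔭∣P 𝔭∣Q =
      let a , b , aP+bQ≈1 = P,Q-comaximal
      in prime∤unit 𝔭-prime (1# , *-identityʳ 1#)
           (∣-respʳ aP+bQ≈1 (∣m∣n⇒∣m+n (∣n⇒∣m*n a 𝔭∣P) (∣n⇒∣m*n b 𝔭∣Q)))

    prime∣Δ⇒∤P : 2 < p → 𝔭 ∣ Δ → ¬ 𝔭 ∣ P
    prime∣Δ⇒∤P 2<p 𝔭∣Δ 𝔭∣P with prime∣*⇒∣⊎∣ 𝔭-prime 2# (2# * Q) 𝔭∣4Q
      where
        𝔭∣4Q : 𝔭 ∣ 2# * (2# * Q)
        𝔭∣4Q = ∣-respʳ (solve 2 (λ P Q → P :* P :- (P :* P :- (Q :+ Q :+ Q :+ Q)) := 𝟐 :* (𝟐 :* Q)) refl P Q)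
                       (∣m∣n⇒∣m-n (∣n⇒∣m*n P 𝔭∣P) 𝔭∣Δ)
    ... | inj₁ 𝔭∣2  = prime∤2 2<p 𝔭∣2
    ... | inj₂ 𝔭∣2Q with prime∣*⇒∣⊎∣ 𝔭-prime 2# Q 𝔭∣2Q
    ...   | inj₁ 𝔭∣2 = prime∤2 2<p 𝔭∣2
    ...   | inj₂ 𝔭∣Q = prime∣P⇒∤Q 𝔭∣P 𝔭∣Q

    prime∣Δ⇒[∣U[n+1]⇒∣[n+1]P^n] : 𝔭 ∣ Δ → ∀ n → 𝔭 ∣ U (suc n) → 𝔭 ∣ suc n · 1# * P ^ n
    prime∣Δ⇒[∣U[n+1]⇒∣[n+1]P^n] 𝔭∣Δ n 𝔭∣U with 2^n*U[n+1]≡[n+1]P^n[mod-Δ] n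
    ... | b , 2^nU≈ = ∣m+n∣n⇒∣m (∣-respʳ 2^nU≈ (∣n⇒∣m*n (2# ^ n) 𝔭∣U)) (∣m⇒∣m*n b 𝔭∣Δ)

    prime∣Δ⇒∤U : 𝔭 ∣ Δ → ∀ m → 1 ≤ m → m < p → ¬ 𝔭 ∣ U m
    prime∣Δ⇒∤U 𝔭∣Δ (suc zero)    _ _   = prime∤unit 𝔭-prime (1# , *-identityʳ 1#)
    prime∣Δ⇒∤U 𝔭∣Δ (suc (suc n)) _ m<p =
      [ prime∤unit 𝔭-prime (·1-isUnit p-prime p≈0 (s≤s z≤n) m<p)
      , prime∣Δ⇒∤P 2<p 𝔭∣Δ ∘ prime∣^⇒∣ 𝔭-prime P (suc n)
      ]′ ∘ prime∣*⇒∣⊎∣ 𝔭-prime (suc (suc n) · 1#) (P ^ suc n) ∘ prime∣Δ⇒[∣U[n+1]⇒∣[n+1]P^n] 𝔭∣Δ (suc n)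
      where
        2<p : 2 < p
        2<p = ℕ.<-≤-trans (s≤s (s≤s (s≤s z≤n))) m<p

    prime∣U[2]⇔∣Δ : 2# ≈ 0# → 𝔭 ∣ U 2 ⇔ 𝔭 ∣ Δ
    prime∣U[2]⇔∣Δ 2≈0 = mk⇔
      (λ 𝔭∣U[2] → ∣-respʳ (sym Δ≈P*P) (∣m⇒∣m*n P (∣-respʳ U[2]≈P 𝔭∣U[2])))
      (λ 𝔭∣Δ → ∣-respʳ (sym U[2]≈P) ([ id , id ]′ (prime∣*⇒∣⊎∣ 𝔭-prime P P (∣-respʳ Δ≈P*P 𝔭∣Δ))))
      where
        U[2]≈P : U 2 ≈ P
        U[2]≈P = solve 2 (λ P Q → P :* 𝟏 :- Q :* 𝟎 := P) refl P Q
        Δ≈P*P : Δ ≈ P * P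
        Δ≈P*P = begin
          P * P - (Q + Q + Q + Q)  ≈⟨ solve 2 (λ P Q → P :* P :- (Q :+ Q :+ Q :+ Q) := P :* P :- 𝟐 :* (𝟐 :* Q)) refl P Q ⟩
          P * P - 2# * (2# * Q)    ≈⟨ +-congˡ (-‿cong (*-congʳ 2≈0)) ⟩
          P * P - 0# * (2# * Q)    ≈⟨ solve 2 (λ P x → P :* P :- 𝟎 :* x := P :* P) refl P (2# * Q) ⟩
          P * P                    ∎

    prime∣U[p]⇔∣Δ-odd : ∀ m → p ≡ suc (suc m ℕ.+ suc m) → 𝔭 ∣ U p ⇔ 𝔭 ∣ Δ
    prime∣U[p]⇔∣Δ-odd m p≡2m+3 = mk⇔
      (λ 𝔭∣U[p] → prime∣^⇒∣ 𝔭-prime Δ (suc m) (∣-respʳ 2^[p-1]U[p]≈Δ^[m+1] (∣n⇒∣m*n 2^[p-1] 𝔭∣U[p])))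
      (λ 𝔭∣Δ → [ ⊥-elim ∘ prime∤2 2<p ∘ prime∣^⇒∣ 𝔭-prime 2# (suc m ℕ.+ suc m) , id ]′
                 (prime∣*⇒∣⊎∣ 𝔭-prime 2^[p-1] (U p) (∣-respʳ (sym 2^[p-1]U[p]≈Δ^[m+1]) (∣m⇒∣m*n (Δ ^ m) 𝔭∣Δ))))
      where
        2^[p-1] : Carrier
        2^[p-1] = 2# ^ (suc m ℕ.+ suc m)
        2^[p-1]U[p]≈Δ^[m+1] : 2^[p-1] * U p ≈ Δ ^ suc m
        2^[p-1]U[p]≈Δ^[m+1] = 2^[p-1]*U[p]≈Δ^[[p-1]/2] {m = suc m} p-prime p≈0 p≡2m+3
        2<p : 2 < p
        2<p = ≡.subst (2 <_) (≡.sym p≡2m+3) (s≤s (s≤s (ℕ.≤-trans (s≤s z≤n) (ℕ.m≤n+m (suc m) m))))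

    prime∣U[p]⇔∣Δ : 𝔭 ∣ U p ⇔ 𝔭 ∣ Δ
    prime∣U[p]⇔∣Δ = [ p≡2-case , odd-case ]′ (prime≡2⊎odd p-prime)
      where
        p≡2-case : p ≡ 2 → 𝔭 ∣ U p ⇔ 𝔭 ∣ Δ
        p≡2-case p≡2 = ≡.subst (λ n → 𝔭 ∣ U n ⇔ 𝔭 ∣ Δ) (≡.sym p≡2)
          (prime∣U[2]⇔∣Δ (trans (+-congˡ (sym (+-identityʳ 1#))) (≡.subst (λ n → n · 1# ≈ 0#) p≡2 p≈0)))
        odd-case : ∃[ m ] p ≡ suc (suc m ℕ.+ suc m) → 𝔭 ∣ U p ⇔ 𝔭 ∣ Δ
        odd-case (m , p≡2m+3) = prime∣U[p]⇔∣Δ-odd m p≡2m+3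

    prime∣Δ⇒rank≡p : 𝔭 ∣ Δ → RankOfAppearanceIs R U 𝔭 p
    prime∣Δ⇒rank≡p 𝔭∣Δ = ℕ.<⇒≤ (prime>1 p-prime) , Equivalence.from prime∣U[p]⇔∣Δ 𝔭∣Δ , prime∣Δ⇒∤U 𝔭∣Δ

    rank≡p⇒prime∣Δ : RankOfAppearanceIs R U 𝔭 p → 𝔭 ∣ Δ
    rank≡p⇒prime∣Δ (_ , 𝔭∣U[p] , _) = Equivalence.to prime∣U[p]⇔∣Δ 𝔭∣U[p]

mainTheorem12 : ∀ {c ℓ} (R : CommutativeRing c ℓ) (p : ℕ)
    → IsUFD R → Prime p → HasCharacteristic R p
    → (P Q : CommutativeRing.Carrier R)
    → ¬ (CommutativeRing._≈_ R P (CommutativeRing.0# R))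
    → ¬ (CommutativeRing._≈_ R Q (CommutativeRing.0# R))
    → IsRegular R P Q
    → (𝔭 : CommutativeRing.Carrier R) → PrimeElement R 𝔭
    → RankOfAppearanceFinite R (lucasU R P Q) 𝔭
    → Divides R 𝔭 (discriminant R P Q) ⇔ RankOfAppearanceIs R (lucasU R P Q) 𝔭 p
mainTheorem12 R p _ p-prime (_ , natCast[p]≈0 , _) P Q _ _ (_ , P,Q-comaximal) 𝔭 𝔭-prime _ =
  mk⇔ (prime∣Δ⇒rank≡p R p-prime p≈0 P,Q-comaximal 𝔭-prime) (rank≡p⇒prime∣Δ R p-prime p≈0 P,Q-comaximal 𝔭-prime)
  where
    open CommutativeRing R using (trans; sym)
    p≈0 = trans (sym (natCast≈·1 R p)) natCast[p]≈0
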